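{- Let $I$ be a biconvex subset of the positive roots of the root system $A_n$, and let $G$ be the graph on vertex set $\{1,\ldots,n+1\}$ with an edge $ij$ for each $e_i-e_j\in I$. Then every chordless cycle in $G$ has length at most $4$.
   Context: The positive roots of $A_n$ are realized as $R^+=\{e_i-e_j: 1\le i<j\le n+1\}$, with $e_1,\dots,e_{n+1}$ the standard basis of $\mathbb{R}^{n+1}$. A subset $I\subseteq R^+$ is convex if $\alpha,\beta\in I$ and $\alpha+\beta\in R^+$ imply $\alpha+\beta\in I$; coconvex if $R^+\setminus I$ is convex; biconvex if both. A cycle in a graph has a chord if some edge of the graph joins two non-consecutive vertices of the cycle; a chordless cycle is a cycle with no chord. -}

module Defs where

open import Data.Nat using (ℕ; zero; suc; _≤_)
open import Data.Fin using (Fin; toℕ; _<_; _≟_)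
open import Data.Integer using (ℤ; +_; -_; _+_)
open import Data.Bool using (Bool; true; false; if_then_else_)
open import Data.Product using (Σ; _×_; _,_; proj₁; proj₂; Σ-syntax)
open import Data.Sum using (_⊎_)
open import Relation.Nullary using (¬_; does)
open import Relation.Binary.PropositionalEquality using (_≡_)
open import Function.Definitions using (Injective)

-- Root system A_n lives in ℝ^(n+1); we index the standard basis by Fin (suc n)
-- (so e_1,...,e_{n+1} become e_0,...,e_n). Coordinates are integral, so ℤ suffices.

e : {m : ℕ} → Fin m → Fin m → ℤ
e i k = if does (i ≟ k) then + 1 else + 0

record PosRoot (n : ℕ) : Set where
  constructor root
  field
    src : Fin (suc n)
    tgt : Fin (suc n)
    lt  : src < tgt
open PosRoot public

vec : {n : ℕ} → PosRoot n → Fin (suc n) → ℤ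
vec r k = e (src r) k + - e (tgt r) k

SumIs : {n : ℕ} → PosRoot n → PosRoot n → PosRoot n → Set
SumIs α β γ = ∀ k → vec α k + vec β k ≡ vec γ k

-- a subset of R⁺ (finite, hence given by its characteristic function)
RootSubset : ℕ → Set
RootSubset n = PosRoot n → Bool

_∈R_ : {n : ℕ} → PosRoot n → RootSubset n → Set
r ∈R I = I r ≡ true

Convex : {n : ℕ} → RootSubset n → Set
Convex {n} I = (α β γ : PosRoot n) → α ∈R I → β ∈R I → SumIs α β γ → γ ∈R I

complement : {n : ℕ} → RootSubset n → RootSubset n
complement I r = if I r then false else true

Coconvex : {n : ℕ} → RootSubset n → Set
Coconvex I = Convex (complement I)

Biconvex : {n : ℕ} → RootSubset n → Set
Biconvex I = Convex I × Coconvex I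

Adj : {n : ℕ} → RootSubset n → Fin (suc n) → Fin (suc n) → Set
Adj {n} I a b = Σ[ r ∈ PosRoot n ] (r ∈R I ×
  ((src r ≡ a × tgt r ≡ b) ⊎ (src r ≡ b × tgt r ≡ a)))

CycNext : ℕ → ℕ → ℕ → Set
CycNext k a b = (suc a ≡ b) ⊎ (suc a ≡ k × b ≡ 0)

Consecutive : (k : ℕ) → Fin k → Fin k → Set
Consecutive k p q = CycNext k (toℕ p) (toℕ q) ⊎ CycNext k (toℕ q) (toℕ p)

record Cycle {n : ℕ} (I : RootSubset n) (k : ℕ) : Set where
  field
    len≥3    : 3 ≤ k
    vertex   : Fin k → Fin (suc n)
    distinct : Injective _≡_ _≡_ vertex
    edges    : (p q : Fin k) → CycNext k (toℕ p) (toℕ q) → Adj I (vertex p) (vertex q)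
open Cycle public

Chordless : {n : ℕ} {I : RootSubset n} {k : ℕ} → Cycle I k → Set
Chordless {I = I} {k} C = (p q : Fin k) → ¬ (p ≡ q) → ¬ Consecutive k p q →
  ¬ Adj I (vertex C p) (vertex C q)

module Submission where

open import Defs
open import Data.Nat as ℕ using (ℕ; zero; suc; s≤s; _≤_; _+_; _*_; _∸_)
import Data.Nat.Properties as ℕ
open import Data.Fin as Fin using (Fin; toℕ; zero; suc; lower₁; inject₁; fromℕ)
import Data.Fin.Properties as Fin
import Data.Integer as ℤ
open import Data.Integer.Tactic.RingSolver using (solve-∀)
open import Data.Bool using (true; false)
open import Data.List using (allFin)
import Data.List.Extrema as Extrema
import Data.List.Relation.Unary.All as All
open import Data.List.Membership.Propositional.Properties using (∈-allFin)
open import Data.Product using (∃; _,_; proj₁; proj₂)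
open import Data.Sum using (_⊎_; inj₁; inj₂; [_,_])
open import Data.Empty using (⊥-elim)
open import Function using (_∘_)
open import Relation.Nullary using (¬_; yes; no)
open import Relation.Binary using (tri<; tri≈; tri>)
open import Relation.Binary.PropositionalEquality using (_≡_; _≢_; refl; sym; trans; cong; subst; module ≡-Reasoning)

-- Let u₀–u₁–u₂–u₃–u₄ be five consecutive vertices of a cycle of length at least 5,
-- with u₂ the smallest vertex of the cycle.  Convexity of I forces u₄ < u₃ (else
-- u₂u₄ is an edge) and u₀ < u₁ (else u₂u₀ is).  If u₃ < u₁, coconvexity applied to
-- u₂ < u₄ < u₁ gives one of the chords u₂u₄, u₄u₁; if u₁ < u₃, applied to
-- u₂ < u₀ < u₃ it gives u₂u₀ or u₀u₃.  So the cycle is not chordless.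

[p-q]+[q-r]≡p-r : ∀ p q r → (p ℤ.+ ℤ.- q) ℤ.+ (q ℤ.+ ℤ.- r) ≡ p ℤ.+ ℤ.- r
[p-q]+[q-r]≡p-r = solve-∀

SumIs-root-concat : ∀ {n} {a b c : Fin (suc n)}
  (a<b : a Fin.< b) (b<c : b Fin.< c) (a<c : a Fin.< c) →
  SumIs (root a b a<b) (root b c b<c) (root a c a<c)
SumIs-root-concat {a = a} {b} {c} _ _ _ k = [p-q]+[q-r]≡p-r (e a k) (e b k) (e c k)

∉⇒∈complement : ∀ {n} {I : RootSubset n} {r} → I r ≡ false → r ∈R complement I
∉⇒∈complement r∉I rewrite r∉I = refl

∈⇒∉complement : ∀ {n} {I : RootSubset n} {r} → r ∈R I → ¬ r ∈R complement I
∈⇒∉complement r∈I rewrite r∈I = λ ()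

module _ {n : ℕ} {I : RootSubset n} where

  Adj-sym : ∀ {a b} → Adj I a b → Adj I b a
  Adj-sym (r , r∈I , inj₁ ends) = r , r∈I , inj₂ ends
  Adj-sym (r , r∈I , inj₂ ends) = r , r∈I , inj₁ ends

  Adj-irrefl : ∀ {a} → ¬ Adj I a a
  Adj-irrefl (root _ _ s<t , _ , inj₁ (refl , refl)) = Fin.<-irrefl refl s<t
  Adj-irrefl (root _ _ s<t , _ , inj₂ (refl , refl)) = Fin.<-irrefl refl s<t

  ≤∧Adj⇒< : ∀ {a b} → a Fin.≤ b → Adj I a b → a Fin.< b
  ≤∧Adj⇒< a≤b ab = Fin.≤∧≢⇒< a≤b λ { refl → Adj-irrefl ab }

  ∈⇒Adj : ∀ {a b} {a<b : a Fin.< b} → root a b a<b ∈R I → Adj I a b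
  ∈⇒Adj r∈I = _ , r∈I , inj₁ (refl , refl)

  Adj⇒∈ : ∀ {a b} (a<b : a Fin.< b) → Adj I a b → root a b a<b ∈R I
  Adj⇒∈ a<b (root _ _ s<t , r∈I , inj₁ (refl , refl)) =
    subst (λ l → root _ _ l ∈R I) (Fin.<-irrelevant s<t a<b) r∈I
  Adj⇒∈ a<b (root _ _ s<t , _ , inj₂ (refl , refl)) = ⊥-elim (Fin.<-asym a<b s<t)

  Adj-join : Convex I → ∀ {a b c} → a Fin.< b → b Fin.< c →
    Adj I a b → Adj I b c → Adj I a c
  Adj-join cv a<b b<c ab bc = ∈⇒Adj {a<b = a<c}
    (cv _ _ _ (Adj⇒∈ a<b ab) (Adj⇒∈ b<c bc) (SumIs-root-concat a<b b<c a<c))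
    where a<c = Fin.<-trans a<b b<c

  Adj-split : Coconvex I → ∀ {a b c} → (a<b : a Fin.< b) → (b<c : b Fin.< c) →
    Adj I a c → Adj I a b ⊎ Adj I b c
  Adj-split cc a<b b<c ac with I (root _ _ a<b) in ab | I (root _ _ b<c) in bc
  ... | true  | _     = inj₁ (∈⇒Adj ab)
  ... | false | true  = inj₂ (∈⇒Adj bc)
  ... | false | false = ⊥-elim (∈⇒∉complement {I = I} (Adj⇒∈ a<c ac)
    (cc _ _ _ (∉⇒∈complement {I = I} ab) (∉⇒∈complement {I = I} bc)
      (SumIs-root-concat a<b b<c a<c)))
    where a<c = Fin.<-trans a<b b<c

  path-from-minimum-has-chord : Biconvex I → ∀ {u₀ u₁ u₂ u₃ u₄} →
    u₂ Fin.≤ u₀ → u₂ Fin.≤ u₁ → u₂ Fin.≤ u₃ → u₂ Fin.≤ u₄ →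
    Adj I u₀ u₁ → Adj I u₁ u₂ → Adj I u₂ u₃ → Adj I u₃ u₄ →
    Adj I u₀ u₂ ⊎ Adj I u₂ u₄ ⊎ Adj I u₀ u₃ ⊎ Adj I u₁ u₄
  path-from-minimum-has-chord (cv , cc) {u₀} {u₁} {u₂} {u₃} {u₄}
    ≤u₀ ≤u₁ ≤u₃ ≤u₄ e₀₁ e₁₂ e₂₃ e₃₄ with u₂ Fin.≟ u₀ | u₂ Fin.≟ u₄
  ... | yes refl | _        = inj₂ (inj₂ (inj₁ e₂₃))
  ... | no _     | yes refl = inj₂ (inj₂ (inj₂ e₁₂))
  ... | no u₂≢u₀ | no u₂≢u₄ with Fin.<-cmp u₃ u₄ | Fin.<-cmp u₁ u₀
  ... | tri≈ _ refl _ | _ = ⊥-elim (Adj-irrefl e₃₄)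
  ... | _ | tri≈ _ refl _ = ⊥-elim (Adj-irrefl e₀₁)
  ... | tri< u₃<u₄ _ _ | _ = inj₂ (inj₁ (Adj-join cv (≤∧Adj⇒< ≤u₃ e₂₃) u₃<u₄ e₂₃ e₃₄))
  ... | tri> _ _ _ | tri< u₁<u₀ _ _ =
    inj₁ (Adj-sym (Adj-join cv (≤∧Adj⇒< ≤u₁ (Adj-sym e₁₂)) u₁<u₀ (Adj-sym e₁₂) (Adj-sym e₀₁)))
  ... | tri> _ _ u₄<u₃ | tri> _ _ u₀<u₁ with Fin.<-cmp u₃ u₁
  ...   | tri≈ _ refl _ = inj₂ (inj₂ (inj₁ e₀₁))
  ...   | tri< u₃<u₁ _ _ = [ inj₂ ∘ inj₁ , inj₂ ∘ inj₂ ∘ inj₂ ∘ Adj-sym ]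
    (Adj-split cc (Fin.≤∧≢⇒< ≤u₄ u₂≢u₄) (Fin.<-trans u₄<u₃ u₃<u₁) (Adj-sym e₁₂))
  ...   | tri> _ _ u₁<u₃ = [ inj₁ ∘ Adj-sym , inj₂ ∘ inj₂ ∘ inj₁ ]
    (Adj-split cc (Fin.≤∧≢⇒< ≤u₀ u₂≢u₀) (Fin.<-trans u₀<u₁ u₁<u₃) e₂₃)

CycNext-functional : ∀ {k a b c} → b ℕ.< k → c ℕ.< k →
  CycNext k a b → CycNext k a c → b ≡ c
CycNext-functional _   _   (inj₁ refl)       (inj₁ refl)       = refl
CycNext-functional b<k _   (inj₁ refl)       (inj₂ (refl , _)) = ⊥-elim (ℕ.<-irrefl refl b<k)
CycNext-functional _   c<k (inj₂ (refl , _)) (inj₁ refl)       = ⊥-elim (ℕ.<-irrefl refl c<k)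
CycNext-functional _   _   (inj₂ (_ , refl)) (inj₂ (_ , refl)) = refl

CycNext⇒suc≡+* : ∀ {k a b} → CycNext k a b → ∃ λ c → suc a ≡ b + c * k
CycNext⇒suc≡+* (inj₁ refl)       = 0 , sym (ℕ.+-identityʳ _)
CycNext⇒suc≡+* (inj₂ (eq , refl)) = 1 , trans eq (sym (ℕ.+-identityʳ _))

0<m*[1+n]⇒n<m*[1+n] : ∀ m n → 0 ℕ.< m * suc n → n ℕ.< m * suc n
0<m*[1+n]⇒n<m*[1+n] (suc m) n _ = ℕ.m≤m+n (suc n) (m * suc n)

minimiser : ∀ {K m} (f : Fin (suc K) → Fin m) → ∃ λ p → ∀ q → f p Fin.≤ f q
minimiser {K} {m} f = argmin f zero (allFin (suc K)) ,
  λ q → All.lookup (f[argmin]≤f[xs] {f = f} zero (allFin (suc K))) (∈-allFin q)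
  where open Extrema (Fin.≤-totalOrder m)

module _ {K : ℕ} where

  next : Fin (suc K) → Fin (suc K)
  next i with K ℕ.≟ toℕ i
  ... | yes _   = zero
  ... | no K≢i = suc (lower₁ i K≢i)

  CycNext-next : ∀ i → CycNext (suc K) (toℕ i) (toℕ (next i))
  CycNext-next i with K ℕ.≟ toℕ i
  ... | yes K≡i = inj₂ (cong suc (sym K≡i) , refl)
  ... | no K≢i = inj₁ (cong suc (sym (Fin.toℕ-lower₁ i K≢i)))

  CycNext⇒≡next : ∀ {i j} → CycNext (suc K) (toℕ i) (toℕ j) → j ≡ next i
  CycNext⇒≡next {i} {j} i→j = Fin.toℕ-injective
    (CycNext-functional (Fin.toℕ<n j) (Fin.toℕ<n (next i)) i→j (CycNext-next i))

  prev : Fin (suc K) → Fin (suc K)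
  prev zero    = fromℕ K
  prev (suc i) = inject₁ i

  CycNext-prev : ∀ i → CycNext (suc K) (toℕ (prev i)) (toℕ i)
  CycNext-prev zero    = inj₂ (cong suc (Fin.toℕ-fromℕ K) , refl)
  CycNext-prev (suc i) = inj₁ (cong suc (Fin.toℕ-inject₁ i))

  next-prev : ∀ i → next (prev i) ≡ i
  next-prev i = sym (CycNext⇒≡next (CycNext-prev i))

  next^ : ℕ → Fin (suc K) → Fin (suc K)
  next^ zero    x = x
  next^ (suc j) x = next (next^ j x)

  next^-+ : ∀ i j x → next^ (i + j) x ≡ next^ i (next^ j x)
  next^-+ zero    j x = refl
  next^-+ (suc i) j x = cong next (next^-+ i j x)

  toℕ-next^ : ∀ j x → ∃ λ c → toℕ x + j ≡ toℕ (next^ j x) + c * suc K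
  toℕ-next^ zero    x = 0 , refl
  toℕ-next^ (suc j) x with toℕ-next^ j x | CycNext⇒suc≡+* (CycNext-next (next^ j x))
  ... | c , ih | c′ , step = c′ + c , (begin
    toℕ x + suc j                                    ≡⟨ ℕ.+-suc (toℕ x) j ⟩
    suc (toℕ x + j)                                  ≡⟨ cong suc ih ⟩
    suc (toℕ y) + c * suc K                          ≡⟨ cong (_+ c * suc K) step ⟩
    toℕ (next y) + c′ * suc K + c * suc K            ≡⟨ ℕ.+-assoc (toℕ (next y)) (c′ * suc K) _ ⟩
    toℕ (next y) + (c′ * suc K + c * suc K)          ≡⟨ cong (toℕ (next y) +_) (ℕ.*-distribʳ-+ (suc K) c′ c) ⟨
    toℕ (next y) + (c′ + c) * suc K                  ∎)
    where
    open ≡-Reasoning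
    y : Fin (suc K)
    y = next^ j x

  next^-fixpoint-free : ∀ {d} x → 0 ℕ.< d → d ≤ K → next^ d x ≢ x
  next^-fixpoint-free {d} x 0<d d≤K fixed with toℕ-next^ d x
  ... | c , eq = ℕ.<⇒≱ (0<m*[1+n]⇒n<m*[1+n] c K (subst (0 ℕ.<_) d≡cK 0<d))
                       (subst (_≤ K) d≡cK d≤K)
    where
    d≡cK : d ≡ c * suc K
    d≡cK = ℕ.+-cancelˡ-≡ (toℕ x) d (c * suc K)
      (trans eq (cong (λ y → toℕ y + c * suc K) fixed))

  next^-distinct : ∀ {i j} x → i ℕ.< j → j ≤ i + K → next^ i x ≢ next^ j x
  next^-distinct {i} {j} x i<j j≤i+K eq =
    next^-fixpoint-free (next^ i x) (ℕ.m<n⇒0<n∸m i<j) (ℕ.m≤n+o⇒m∸n≤o j i j≤i+K) (begin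
      next^ (j ∸ i) (next^ i x) ≡⟨ next^-+ (j ∸ i) i x ⟨
      next^ (j ∸ i + i) x       ≡⟨ cong (λ m → next^ m x) (ℕ.m∸n+n≡m (ℕ.<⇒≤ i<j)) ⟩
      next^ j x                 ≡⟨ eq ⟨
      next^ i x                 ∎)
    where open ≡-Reasoning

  next^-nonconsecutive : ∀ {i j} x → suc i ℕ.< j → j ℕ.< i + K →
    ¬ Consecutive (suc K) (next^ i x) (next^ j x)
  next^-nonconsecutive x 1+i<j j<i+K (inj₁ i→j) =
    next^-distinct x 1+i<j (ℕ.m≤n⇒m≤1+n (ℕ.<⇒≤ j<i+K)) (sym (CycNext⇒≡next i→j))
  next^-nonconsecutive x 1+i<j j<i+K (inj₂ j→i) =
    next^-distinct x (ℕ.m≤n⇒m≤1+n (ℕ.<⇒≤ 1+i<j)) j<i+K (CycNext⇒≡next j→i)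

Chordless⇒¬Adj-next^ : ∀ {n} {I : RootSubset n} {K} (C : Cycle I (suc K)) → Chordless C →
  ∀ {i j} x → suc i ℕ.< j → j ℕ.< i + K →
  ¬ Adj I (vertex C (next^ i x)) (vertex C (next^ j x))
Chordless⇒¬Adj-next^ C chordless x 1+i<j j<i+K = chordless _ _
  (next^-distinct x (ℕ.<-trans (ℕ.n<1+n _) 1+i<j) (ℕ.<⇒≤ j<i+K))
  (next^-nonconsecutive x 1+i<j j<i+K)

no-long-chordless-cycle : ∀ {n} {I : RootSubset n} → Biconvex I →
  ∀ {k} (C : Cycle I k) → Chordless C → ¬ 4 ℕ.< k
no-long-chordless-cycle {n} {I} biconvex {suc K} C chordless (s≤s 4≤K) =
  [ no-chord 0 2 ℕ.≤-refl (ℕ.≤-trans (ℕ.n≤1+n 3) 4≤K)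
  , [ no-chord 2 4 ℕ.≤-refl (s≤s (ℕ.m≤n⇒m≤1+n 4≤K))
  , [ no-chord 0 3 (ℕ.n≤1+n 2) 4≤K
    , no-chord 1 4 (ℕ.n≤1+n 3) (s≤s 4≤K) ] ] ]
  (path-from-minimum-has-chord biconvex
    (u₂-minimal 0) (u₂-minimal 1) (u₂-minimal 3) (u₂-minimal 4)
    (edge 0) (edge 1) (edge 2) (edge 3))
  where
  p : Fin (suc K)
  p = proj₁ (minimiser (vertex C))
  u : ℕ → Fin (suc n)
  u i = vertex C (next^ i (prev (prev p)))
  u₂-minimal : ∀ i → u 2 Fin.≤ u i
  u₂-minimal i rewrite next-prev (prev p) | next-prev p = proj₂ (minimiser (vertex C)) _
  edge : ∀ i → Adj I (u i) (u (suc i))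
  edge i = edges C _ _ (CycNext-next _)
  no-chord : ∀ i j → suc i ℕ.< j → j ℕ.< i + K → ¬ Adj I (u i) (u j)
  no-chord i j = Chordless⇒¬Adj-next^ C chordless _

lemma8p1 : (n : ℕ) (I : RootSubset n) → Biconvex I →
    (k : ℕ) (C : Cycle I k) → Chordless C → k ≤ 4
lemma8p1 n I biconvex k C chordless = ℕ.≮⇒≥ (no-long-chordless-cycle biconvex C chordless)
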